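{- For a nonnegative integer $n$, let $\mathcal{B}_n$ be the set of integer sequences $(v_1,\ldots,v_n)$ satisfying $1\le v_i\le i$ for all $i$, and such that for all $1\le i<j\le n$, $v_j-(j-i)\notin[1,v_i-1]$. Then $|\mathcal{B}_n|=C_n=\frac{1}{n+1}\binom{2n}{n}$.
   Context: $[a,b]$ denotes the set of integers $m$ with $a\le m\le b$ (empty if $b<a$). For $n=0$ the only sequence is the empty one. -}

module Defs where

open import Data.Nat as ℕ using (ℕ; suc; _∸_)
open import Data.Nat.DivMod using (_/_)
open import Data.Nat.Combinatorics using (_C_)
open import Data.Integer as ℤ using (ℤ; +_; _-_; _≤_)
open import Data.Integer.Properties using (_≤?_)
open import Data.Fin using (Fin; toℕ)
open import Data.Fin.Properties using (all?)
open import Data.Vec using (Vec; lookup)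
open import Data.Product using (_×_)
open import Relation.Nullary using (¬_; Dec)
open import Relation.Nullary.Decidable using (_×-dec_; _→-dec_; ¬?)

catalan : ℕ → ℕ
catalan n = ((2 ℕ.* n) C n) / suc n

_∈[_,_] : ℤ → ℤ → ℤ → Set
m ∈[ a , b ] = (a ≤ m) × (m ≤ b)

-- A sequence (v_1,…,v_n) is stored as v : Vec ℤ n, with v_{i+1} = lookup v i
-- for i : Fin n (0-based index i corresponds to 1-based position toℕ i + 1).
-- The 1-based difference j - i equals toℕ j ∸ toℕ i.
InB : ∀ {n} → Vec ℤ n → Set
InB {n} v =
  ((i : Fin n) → (+ 1 ≤ lookup v i) × (lookup v i ≤ + (suc (toℕ i))))
  × ((i j : Fin n) → toℕ i ℕ.< toℕ j →
       ¬ ((lookup v j - + (toℕ j ∸ toℕ i)) ∈[ + 1 , lookup v i - + 1 ]))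

InB? : ∀ {n} (v : Vec ℤ n) → Dec (InB v)
InB? v =
  all? (λ i → (+ 1 ≤? lookup v i) ×-dec (lookup v i ≤? + (suc (toℕ i))))
  ×-dec all? (λ i → all? (λ j → (toℕ i ℕ.<? toℕ j) →-dec
          ¬? ((+ 1 ≤? (lookup v j - + (toℕ j ∸ toℕ i)))
              ×-dec ((lookup v j - + (toℕ j ∸ toℕ i)) ≤? (lookup v i - + 1)))))

module Submission where

-- After a prefix has been read, the values
-- still admissible k positions further on form [1, k] ∪ { V i + k | i < s } for some
-- strictly decreasing positive V : [0, s) → ℕ, the anchors (initially V = 1, s = 1).
-- The next entry must be an anchor V r; reading it shifts the anchors V 0, …, V r by
-- one, discards the others (exactly the ones it blocks) and adds the anchor 1, so s
-- becomes r + 2. Hence 𝓑ₙ is in bijection with the choice sequences r₁ < 1,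
-- r_{t+1} < r_t + 2, counted by ballot n 1 where
-- ballot (m + 1) s = Σ_{r < s} ballot m (r + 2); the ballot-type formula
-- ballot (m + 1) s = C(2m + 1 + s, m + 1) − C(2m + 1 + s, m) then gives ballot n 1 = Cₙ.

open import Defs
open import Data.Nat using (ℕ)
open import Data.Integer using (ℤ)
open import Data.Fin using (Fin)
open import Data.Vec using (Vec)
open import Data.Product using (Σ)
open import Function.Bundles using (_↔_)
open import Relation.Nullary.Decidable using (True)

open import Data.Nat
open import Data.Nat.Properties
open import Data.Nat.Combinatorics
open import Data.Nat.DivMod using (m*n/n≡m; m/n*n≡m)
open import Data.Nat.Tactic.RingSolver using (solve-∀)
open import Data.Integer as ℤ using (+_; -[1+_]; +≤+)
import Data.Integer.Properties as ℤ
import Data.Integer.Tactic.RingSolver as ℤ-Solver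
open import Data.Fin using (zero; suc; toℕ; fromℕ<)
open import Data.Fin.Properties using (+↔⊎; 1↔⊤; toℕ-fromℕ<; toℕ<n; toℕ-injective)
open import Data.Vec using ([]; _∷_; lookup)
open import Data.Product using (∃-syntax; _×_; _,_; proj₁; proj₂)
open import Data.Product.Function.Dependent.Propositional using (Σ-↔)
open import Data.Product.Function.NonDependent.Propositional using (_×-⇔_)
open import Data.Sum using (_⊎_; inj₁; inj₂)
open import Data.Sum.Function.Propositional using (_⊎-↔_)
open import Data.Unit using (⊤; tt)
open import Data.Empty using (⊥; ⊥-elim)
open import Data.Bool.Properties using (T-irrelevant)
open import Function using (_∘_; const)
open import Function.Bundles using (_⇔_; mk⇔; Equivalence; mk↔ₛ′)
open import Function.Properties.Inverse using (↔-refl; ↔-trans)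
open import Relation.Nullary using (¬_; Dec; yes; no)
open import Relation.Nullary.Decidable using (toWitness; fromWitness)
open import Relation.Binary.Definitions using (tri<; tri≈; tri>)
open import Relation.Binary.PropositionalEquality

open Equivalence using (to; from)

∑< : ℕ → (ℕ → ℕ) → ℕ
∑< zero    g = 0
∑< (suc s) g = g 0 + ∑< s (g ∘ suc)

∑<-suc : ∀ s g → ∑< (suc s) g ≡ ∑< s g + g s
∑<-suc zero    g = +-comm (g 0) 0
∑<-suc (suc s) g = trans (cong (_+_ (g 0)) (∑<-suc s (g ∘ suc))) (sym (+-assoc (g 0) _ _))

ballot : ℕ → ℕ → ℕ
ballot zero    s = 1
ballot (suc m) s = ∑< s (λ r → ballot m (2 + r))

ballot-suc-suc : ∀ m s → ballot (suc m) (suc s) ≡ ballot (suc m) s + ballot m (2 + s)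
ballot-suc-suc m s = ∑<-suc s (λ r → ballot m (2 + r))

ballot+C≡C : ∀ m s → ballot (suc m) s + suc (m + m + s) C m ≡ suc (m + m + s) C suc m
ballot+C≡C m zero rewrite +-identityʳ (m + m) = begin
  suc (m + m) C m              ≡⟨ nCk≡nC[n∸k] (m≤n⇒m≤1+n (m≤m+n m m)) ⟩
  suc (m + m) C (suc (m + m) ∸ m) ≡⟨ cong (suc (m + m) C_) 1+m+m∸m≡1+m ⟩
  suc (m + m) C suc m          ∎
  where
  open ≡-Reasoning
  1+m+m∸m≡1+m : suc (m + m) ∸ m ≡ suc m
  1+m+m∸m≡1+m = trans (+-∸-assoc 1 (m≤n+m m m)) (cong suc (m+n∸n≡m m m))
ballot+C≡C zero (suc s) = begin
  ballot 1 (suc s) + 1  ≡⟨ cong (_+ 1) (ballot-suc-suc 0 s) ⟩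
  ballot 1 s + 1 + 1    ≡⟨ cong (_+ 1) (ballot+C≡C 0 s) ⟩
  suc s C 1 + 1         ≡⟨ +-comm (suc s C 1) 1 ⟩
  1 + suc s C 1         ≡⟨ nCk+nC[k+1]≡[n+1]C[k+1] (suc s) 0 ⟩
  suc (suc s) C 1       ∎
  where open ≡-Reasoning
ballot+C≡C (suc m) (suc s) =
  subst (λ N → b₁₊ + N C suc m ≡ N C suc (suc m)) (cong suc (sym (+-suc (suc m + suc m) s))) (begin
  b₁₊ + suc M C suc m               ≡⟨ cong (_+ suc M C suc m) (ballot-suc-suc (suc m) s) ⟩
  b₁ + b₀ + suc M C suc m           ≡⟨ cong (_+_ (b₁ + b₀)) (nCk+nC[k+1]≡[n+1]C[k+1] M m) ⟨
  b₁ + b₀ + (M C m + M C suc m)     ≡⟨ interchange b₁ b₀ (M C m) (M C suc m) ⟩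
  (b₁ + M C suc m) + (b₀ + M C m)   ≡⟨ cong₂ _+_ (ballot+C≡C (suc m) s) shifted ⟩
  M C suc (suc m) + M C suc m       ≡⟨ +-comm (M C suc (suc m)) (M C suc m) ⟩
  M C suc m + M C suc (suc m)       ≡⟨ nCk+nC[k+1]≡[n+1]C[k+1] M (suc m) ⟩
  suc M C suc (suc m)               ∎)
  where
  open ≡-Reasoning
  M b₁₊ b₁ b₀ : ℕ
  M   = suc (suc m + suc m + s)
  b₁₊ = ballot (suc (suc m)) (suc s)
  b₁  = ballot (suc (suc m)) s
  b₀  = ballot (suc m) (2 + s)
  interchange : ∀ a b c d → a + b + (c + d) ≡ (a + d) + (b + c)
  interchange = solve-∀
  M≡ : ∀ m s → 1 + (m + m + (2 + s)) ≡ 1 + ((1 + m) + (1 + m) + s)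
  M≡ = solve-∀
  shifted : b₀ + M C m ≡ M C suc m
  shifted = subst (λ N → b₀ + N C m ≡ N C suc m) (M≡ m s) (ballot+C≡C m (2 + s))

nCk*k![n∸k]!≡n! : ∀ {n k} → k ≤ n → (n C k) * (k ! * (n ∸ k) !) ≡ n !
nCk*k![n∸k]!≡n! {n} {k} k≤n = trans (cong (_* (k ! * (n ∸ k) !)) (nCk≡n!/k![n-k]! k≤n))
                                    (m/n*n≡m (k![n∸k]!∣n! k≤n))
  where instance _ = k !* (n ∸ k) !≢0

[k+1]*nC[k+1]≡[n∸k]*nCk : ∀ {n k} → k < n → suc k * (n C suc k) ≡ (n ∸ k) * (n C k)
[k+1]*nC[k+1]≡[n∸k]*nCk {n} {k} k<n = *-cancelʳ-≡ _ _ (k ! * (n ∸ suc k) !) (trans lhs≡n! (sym rhs≡n!))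
  where
  instance _ = k !* (n ∸ suc k) !≢0
  lhs≡n! : suc k * (n C suc k) * (k ! * (n ∸ suc k) !) ≡ n !
  lhs≡n! = trans (regroup (suc k) (n C suc k) (k !) ((n ∸ suc k) !)) (nCk*k![n∸k]!≡n! k<n)
    where
    regroup : ∀ x y z w → x * y * (z * w) ≡ y * (x * z * w)
    regroup = solve-∀
  rhs≡n! : (n ∸ k) * (n C k) * (k ! * (n ∸ suc k) !) ≡ n !
  rhs≡n! = begin
    (n ∸ k) * (n C k) * (k ! * (n ∸ suc k) !) ≡⟨ regroup (n ∸ k) (n C k) (k !) ((n ∸ suc k) !) ⟩
    (n C k) * (k ! * ((n ∸ k) * (n ∸ suc k) !))
      ≡⟨ cong (λ x → (n C k) * (k ! * x)) ([n-k]*[n-k-1]!≡[n-k]! k<n) ⟩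
    (n C k) * (k ! * (n ∸ k) !)                 ≡⟨ nCk*k![n∸k]!≡n! (<⇒≤ k<n) ⟩
    n !                                       ∎
    where
    open ≡-Reasoning
    regroup : ∀ x y z w → x * y * (z * w) ≡ y * (z * (x * w))
    regroup = solve-∀

ballot*[2+m]≡central : ∀ m → ballot (suc m) 1 * (2 + m) ≡ (2 * suc m) C suc m
ballot*[2+m]≡central m = +-cancelʳ-≡ (B * (2 + m)) _ _ (begin
    F * (2 + m) + B * (2 + m)   ≡⟨ *-distribʳ-+ (2 + m) F B ⟨
    (F + B) * (2 + m)           ≡⟨ cong (_* (2 + m)) F+B≡A ⟩
    A * (2 + m)                 ≡⟨ split-factor m A ⟩
    suc m * A + A               ≡⟨ cong (_+ A) [1+m]A≡[2+m]B ⟩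
    (2 + m) * B + A             ≡⟨ +-comm ((2 + m) * B) A ⟩
    A + (2 + m) * B             ≡⟨ cong (_+_ A) (*-comm (2 + m) B) ⟩
    A + B * (2 + m)             ∎)
  where
  open ≡-Reasoning
  K F A B : ℕ
  K = 2 * suc m
  F = ballot (suc m) 1
  A = K C suc m
  B = K C m
  split-factor : ∀ m a → a * (2 + m) ≡ (1 + m) * a + a
  split-factor = solve-∀
  K≡ : ∀ m → 1 + (m + m + 1) ≡ 2 * (1 + m)
  K≡ = solve-∀
  F+B≡A : F + B ≡ A
  F+B≡A = subst (λ N → F + N C m ≡ N C suc m) (K≡ m) (ballot+C≡C m 1)
  K∸m≡2+m : K ∸ m ≡ 2 + m
  K∸m≡2+m = trans (cong (_∸ m) (K≡' m)) (m+n∸n≡m (2 + m) m)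
    where
    K≡' : ∀ m → 2 * (1 + m) ≡ 2 + m + m
    K≡' = solve-∀
  [1+m]A≡[2+m]B : suc m * A ≡ (2 + m) * B
  [1+m]A≡[2+m]B = trans ([k+1]*nC[k+1]≡[n∸k]*nCk (m≤m+n (suc m) _)) (cong (_* B) K∸m≡2+m)

catalan≡ballot : ∀ n → catalan n ≡ ballot n 1
catalan≡ballot zero    = refl
catalan≡ballot (suc m) = begin
  ((2 * suc m) C suc m) / (2 + m)         ≡⟨ cong (_/ (2 + m)) (ballot*[2+m]≡central m) ⟨
  ballot (suc m) 1 * (2 + m) / (2 + m)  ≡⟨ m*n/n≡m (ballot (suc m) 1) (2 + m) ⟩
  ballot (suc m) 1                      ∎
  where open ≡-Reasoning

⊎↔Σ-Fin-suc : ∀ {s} (P : Fin (suc s) → Set) → (P zero ⊎ Σ (Fin s) (P ∘ suc)) ↔ Σ (Fin (suc s)) P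
⊎↔Σ-Fin-suc P = mk↔ₛ′ join split join∘split split∘join
  where
  join : _ → Σ _ P
  join (inj₁ x)       = zero , x
  join (inj₂ (r , x)) = suc r , x
  split : Σ _ P → _
  split (zero  , x) = inj₁ x
  split (suc r , x) = inj₂ (r , x)
  join∘split : ∀ y → join (split y) ≡ y
  join∘split (zero  , x) = refl
  join∘split (suc r , x) = refl
  split∘join : ∀ y → split (join y) ≡ y
  split∘join (inj₁ x) = refl
  split∘join (inj₂ y) = refl

Fin-∑<↔Σ : ∀ s g → Fin (∑< s g) ↔ Σ (Fin s) (λ r → Fin (g (toℕ r)))
Fin-∑<↔Σ zero    g = mk↔ₛ′ (λ ()) (λ { (() , _) }) (λ { (() , _) }) (λ ())
Fin-∑<↔Σ (suc s) g =
  ↔-trans +↔⊎ (↔-trans (↔-refl ⊎-↔ Fin-∑<↔Σ s (g ∘ suc)) (⊎↔Σ-Fin-suc _))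

Choices : ℕ → ℕ → Set
Choices zero    s = ⊤
Choices (suc m) s = Σ (Fin s) λ r → Choices m (2 + toℕ r)

Fin-ballot↔Choices : ∀ m s → Fin (ballot m s) ↔ Choices m s
Fin-ballot↔Choices zero    s = 1↔⊤
Fin-ballot↔Choices (suc m) s =
  ↔-trans (Fin-∑<↔Σ s _) (Σ-↔ ↔-refl (Fin-ballot↔Choices m _))

-≤-⇔+≤+ : ∀ i j k l → (i ℤ.- j ℤ.≤ k ℤ.- l) ⇔ (i ℤ.+ l ℤ.≤ k ℤ.+ j)
-≤-⇔+≤+ i j k l = mk⇔
  (λ p → subst₂ ℤ._≤_ (shift₁ i j l) (shift₂ k l j) (ℤ.+-monoˡ-≤ (j ℤ.+ l) p))
  (λ p → subst₂ ℤ._≤_ (unshift₁ i l j) (unshift₂ k j l) (ℤ.+-monoˡ-≤ (ℤ.- j ℤ.- l) p))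
  where
  shift₁ : ∀ a b c → a ℤ.- b ℤ.+ (b ℤ.+ c) ≡ a ℤ.+ c
  shift₁ = ℤ-Solver.solve-∀
  shift₂ : ∀ a b c → a ℤ.- b ℤ.+ (c ℤ.+ b) ≡ a ℤ.+ c
  shift₂ = ℤ-Solver.solve-∀
  unshift₁ : ∀ a b c → a ℤ.+ b ℤ.+ (ℤ.- c ℤ.- b) ≡ a ℤ.- c
  unshift₁ = ℤ-Solver.solve-∀
  unshift₂ : ∀ a b c → a ℤ.+ b ℤ.+ (ℤ.- b ℤ.- c) ≡ a ℤ.- c
  unshift₂ = ℤ-Solver.solve-∀

Blocked : ℕ → ℕ → ℕ → Set
Blocked d x u = d < u × u < x + d

1≤u-d⇔d<u : ∀ d u → (+ 1 ℤ.≤ + u ℤ.- + d) ⇔ (d < u)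
1≤u-d⇔d<u d u = mk⇔
  (λ p → subst (suc d ≤_) (+-identityʳ u) (ℤ.drop‿+≤+ (to (-≤-⇔+≤+ (+ 1) (+ 0) (+ u) (+ d)) p)))
  (λ d<u → from (-≤-⇔+≤+ (+ 1) (+ 0) (+ u) (+ d)) (+≤+ (subst (suc d ≤_) (sym (+-identityʳ u)) d<u)))

u-d≤x-1⇔u<x+d : ∀ d x u → (+ u ℤ.- + d ℤ.≤ + x ℤ.- + 1) ⇔ (u < x + d)
u-d≤x-1⇔u<x+d d x u = mk⇔
  (λ p → subst (_≤ x + d) (+-comm u 1) (ℤ.drop‿+≤+ (to (-≤-⇔+≤+ (+ u) (+ d) (+ x) (+ 1)) p)))
  (λ u<x+d → from (-≤-⇔+≤+ (+ u) (+ d) (+ x) (+ 1)) (+≤+ (subst (_≤ x + d) (+-comm 1 u) u<x+d)))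

∈[1,x-1]⇔Blocked : ∀ d x u → ((+ u ℤ.- + d) ∈[ + 1 , + x ℤ.- + 1 ]) ⇔ Blocked d x u
∈[1,x-1]⇔Blocked d x u = 1≤u-d⇔d<u d u ×-⇔ u-d≤x-1⇔u<x+d d x u

record Frontier (V : ℕ → ℕ) (s : ℕ) : Set where
  field
    decreasing : ∀ {i j} → i < j → j < s → V j < V i
    positive   : ∀ {i} → i < s → 0 < V i

  antitone : ∀ {i j} → i ≤ j → j < s → V j ≤ V i
  antitone i≤j j<s with m≤n⇒m<n∨m≡n i≤j
  ... | inj₁ i<j  = <⇒≤ (decreasing i<j j<s)
  ... | inj₂ refl = ≤-refl

  injective : ∀ {i j} → i < s → j < s → V i ≡ V j → i ≡ j
  injective {i} {j} i<s j<s Vi≡Vj with <-cmp i j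
  ... | tri< i<j _ _ = ⊥-elim (<-irrefl (sym Vi≡Vj) (decreasing i<j j<s))
  ... | tri≈ _ i≡j _ = i≡j
  ... | tri> _ _ j<i = ⊥-elim (<-irrefl Vi≡Vj (decreasing j<i i<s))

after : (ℕ → ℕ) → ℕ → ℕ → ℕ
after V r i with i ≤? r
... | yes _ = suc (V i)
... | no  _ = 1

after-≤ : ∀ V {r i} → i ≤ r → after V r i ≡ suc (V i)
after-≤ V {r} {i} i≤r with i ≤? r
... | yes _   = refl
... | no  i≰r = ⊥-elim (i≰r i≤r)

after-≰ : ∀ V {r i} → ¬ i ≤ r → after V r i ≡ 1
after-≰ V {r} {i} i≰r with i ≤? r
... | yes i≤r = ⊥-elim (i≰r i≤r)
... | no  _   = refl

Frontier-after : ∀ {V s r} → Frontier V s → r < s → Frontier (after V r) (2 + r)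
Frontier-after {V} {r = r} F r<s = record { decreasing = decreasing′ ; positive = positive′ }
  where
  open Frontier F
  positive′ : ∀ {i} → i < 2 + r → 0 < after V r i
  positive′ {i} _ with i ≤? r
  ... | yes _ = z<s
  ... | no  _ = z<s
  decreasing′ : ∀ {i j} → i < j → j < 2 + r → after V r j < after V r i
  decreasing′ {i} {j} i<j j<2+r with j ≤? r
  ... | yes j≤r = subst (suc (V j) <_) (sym (after-≤ V (≤-trans (<⇒≤ i<j) j≤r)))
                        (s<s (decreasing i<j (≤-<-trans j≤r r<s)))
  ... | no  _   = subst (1 <_) (sym (after-≤ V i≤r)) (s<s (positive (≤-<-trans i≤r r<s)))
    where
    i≤r : i ≤ r
    i≤r = ≤-pred (≤-trans i<j (≤-pred j<2+r))

Allowed : (ℕ → ℕ) → ℕ → ℕ → ℕ → Set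
Allowed V s k u = 0 < u × (u ≤ k ⊎ ∃[ i ] (i < s × V i + k ≡ u))

¬Blocked-≤ : ∀ {d x u} → u ≤ d → ¬ Blocked d x u
¬Blocked-≤ u≤d (d<u , _) = <⇒≱ d<u u≤d

¬Blocked-≥ : ∀ {d x u} → x + d ≤ u → ¬ Blocked d x u
¬Blocked-≥ x+d≤u (_ , u<x+d) = <⇒≱ u<x+d x+d≤u

allowed-after⇒ : ∀ {V s r k u} → Frontier V s → r < s →
                 Allowed V s (suc k) u → ¬ Blocked (suc k) (V r) u →
                 Allowed (after V r) (2 + r) k u
allowed-after⇒ {V} {r = r} {k} {u} F r<s (0<u , inj₁ u≤1+k) _ with u ≤? k
... | yes u≤k = 0<u , inj₁ u≤k
... | no  u≰k = 0<u , inj₂ (suc r , ≤-refl ,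
                  trans (cong (_+ k) (after-≰ V (n≮n r))) (≤-antisym (≰⇒> u≰k) u≤1+k))
allowed-after⇒ {V} {r = r} {k} F r<s (0<u , inj₂ (i , i<s , Vi+1+k≡u)) ¬blocked with i ≤? r
... | yes i≤r = 0<u , inj₂ (i , m<n⇒m<1+n (s≤s i≤r) ,
                  trans (cong (_+ k) (after-≤ V i≤r)) (trans (sym (+-suc (V i) k)) Vi+1+k≡u))
... | no  i≰r = ⊥-elim (¬blocked (subst (Blocked (suc k) (V r)) Vi+1+k≡u (1+k<Vi+1+k , Vi+1+k<Vr+1+k)))
  where
  open Frontier F
  1+k<Vi+1+k : suc k < V i + suc k
  1+k<Vi+1+k = +-monoˡ-≤ (suc k) (positive i<s)
  Vi+1+k<Vr+1+k : V i + suc k < V r + suc k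
  Vi+1+k<Vr+1+k = +-monoˡ-< (suc k) (decreasing (≰⇒> i≰r) i<s)

allowed-after⇐ : ∀ {V s r k u} → Frontier V s → r < s →
                 Allowed (after V r) (2 + r) k u →
                 Allowed V s (suc k) u × ¬ Blocked (suc k) (V r) u
allowed-after⇐ F r<s (0<u , inj₁ u≤k) = (0<u , inj₁ (m≤n⇒m≤1+n u≤k)) , ¬Blocked-≤ (m≤n⇒m≤1+n u≤k)
allowed-after⇐ {V} {r = r} {k} {u} F r<s (0<u , inj₂ (i , i<2+r , afterVi+k≡u)) with i ≤? r
-- The with-abstraction unfolds after V r i in the type of afterVi+k≡u.
... | yes i≤r = (0<u , inj₂ (i , ≤-<-trans i≤r r<s , Vi+1+k≡u)) ,
                ¬Blocked-≥ (subst (V r + suc k ≤_) Vi+1+k≡u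
                                  (+-monoˡ-≤ (suc k) (Frontier.antitone F i≤r r<s)))
  where
  Vi+1+k≡u : V i + suc k ≡ u
  Vi+1+k≡u = trans (+-suc (V i) k) afterVi+k≡u
... | no  _   = (0<u , inj₁ u≤1+k) , ¬Blocked-≤ u≤1+k
  where
  u≤1+k : u ≤ suc k
  u≤1+k = ≤-reflexive (sym afterVi+k≡u)

AllowedAt : (ℕ → ℕ) → ℕ → ℕ → ℤ → Set
AllowedAt V s k (+ u)    = Allowed V s k u
AllowedAt V s k -[1+ _ ] = ⊥

NonBlocking : ∀ {m} → Vec ℤ m → Set
NonBlocking {m} v = (i j : Fin m) → toℕ i < toℕ j →
  ¬ ((lookup v j ℤ.- + (toℕ j ∸ toℕ i)) ∈[ + 1 , lookup v i ℤ.- + 1 ])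

Continuation : (ℕ → ℕ) → ℕ → ∀ {m} → Vec ℤ m → Set
Continuation V s {m} w = ((j : Fin m) → AllowedAt V s (toℕ j) (lookup w j)) × NonBlocking w

allowedAt-after⇒ : ∀ {V s r} k x → Frontier V s → r < s →
                   AllowedAt V s (suc k) x → ¬ ((x ℤ.- + suc k) ∈[ + 1 , + V r ℤ.- + 1 ]) →
                   AllowedAt (after V r) (2 + r) k x
allowedAt-after⇒ {V} {r = r} k (+ u) F r<s allowed ¬∈ =
  allowed-after⇒ F r<s allowed (¬∈ ∘ from (∈[1,x-1]⇔Blocked (suc k) (V r) u))

allowedAt-after⇐ : ∀ {V s r} k x → Frontier V s → r < s →
                   AllowedAt (after V r) (2 + r) k x →
                   AllowedAt V s (suc k) x × ¬ ((x ℤ.- + suc k) ∈[ + 1 , + V r ℤ.- + 1 ])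
allowedAt-after⇐ {V} {r = r} k (+ u) F r<s allowed =
  let allowed′ , ¬blocked = allowed-after⇐ F r<s allowed
  in allowed′ , ¬blocked ∘ to (∈[1,x-1]⇔Blocked (suc k) (V r) u)

continuation-∷⇐ : ∀ {V s r m} {w : Vec ℤ m} → Frontier V s → r < s →
                  Continuation (after V r) (2 + r) w → Continuation V s (+ V r ∷ w)
continuation-∷⇐ {V} {s} {r} {w = w} F r<s (allowed , nonBlocking) = allowed′ , nonBlocking′
  where
  allowed′ : ∀ j → AllowedAt V s (toℕ j) (lookup (+ V r ∷ w) j)
  allowed′ zero    = Frontier.positive F r<s , inj₂ (r , r<s , +-identityʳ (V r))
  allowed′ (suc j) = proj₁ (allowedAt-after⇐ (toℕ j) (lookup w j) F r<s (allowed j))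
  nonBlocking′ : NonBlocking (+ V r ∷ w)
  nonBlocking′ zero    (suc j) _ = proj₂ (allowedAt-after⇐ (toℕ j) (lookup w j) F r<s (allowed j))
  nonBlocking′ (suc i) (suc j) (s<s i<j) = nonBlocking i j i<j

continuation-tail : ∀ {V s r m} {w : Vec ℤ m} → Frontier V s → r < s →
                    Continuation V s (+ V r ∷ w) → Continuation (after V r) (2 + r) w
continuation-tail {w = w} F r<s (allowed , nonBlocking) =
  (λ j → allowedAt-after⇒ (toℕ j) (lookup w j) F r<s (allowed (suc j)) (nonBlocking zero (suc j) z<s)) ,
  (λ i j i<j → nonBlocking (suc i) (suc j) (s<s i<j))

head-anchor : ∀ {V s} x → AllowedAt V s 0 x → Σ (Fin s) λ r → x ≡ + V (toℕ r)
head-anchor (+ u) (0<u , inj₁ u≤0)             = ⊥-elim (<⇒≱ 0<u u≤0)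
head-anchor {V} (+ u) (_ , inj₂ (i , i<s , Vi+0≡u)) =
  fromℕ< i<s , cong +_ (trans (sym Vi+0≡u) (trans (+-identityʳ (V i)) (cong V (sym (toℕ-fromℕ< i<s)))))

continuation-∷⇒ : ∀ {V s m} {x} {w : Vec ℤ m} → Frontier V s → Continuation V s (x ∷ w) →
                  Σ (Fin s) λ r → x ≡ + V (toℕ r) × Continuation (after V (toℕ r)) (2 + toℕ r) w
continuation-∷⇒ {x = x} F g with head-anchor x (proj₁ g zero)
... | r , refl = r , refl , continuation-tail F (toℕ<n r) g

decode : (V : ℕ → ℕ) (s : ℕ) → ∀ {m} → Choices m s → Vec ℤ m
decode V s {zero}  tt      = []
decode V s {suc m} (r , c) = + V (toℕ r) ∷ decode (after V (toℕ r)) (2 + toℕ r) c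

decode-continuation : ∀ {V s m} → Frontier V s → (c : Choices m s) → Continuation V s (decode V s c)
decode-continuation {m = zero}  F tt      = (λ ()) , (λ ())
decode-continuation {m = suc m} F (r , c) =
  continuation-∷⇐ F (toℕ<n r) (decode-continuation (Frontier-after F (toℕ<n r)) c)

encode : ∀ {V s m} → Frontier V s → (w : Vec ℤ m) → Continuation V s w → Choices m s
encode F []      _ = tt
encode F (x ∷ w) g with continuation-∷⇒ F g
... | r , _ , g′ = r , encode (Frontier-after F (toℕ<n r)) w g′

decode-encode : ∀ {V s m} (F : Frontier V s) (w : Vec ℤ m) (g : Continuation V s w) →
                decode V s (encode F w g) ≡ w
decode-encode F []      _ = refl
decode-encode F (x ∷ w) g with continuation-∷⇒ F g
... | r , x≡Vr , g′ = cong₂ _∷_ (sym x≡Vr) (decode-encode (Frontier-after F (toℕ<n r)) w g′)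

encode-decode : ∀ {V s m} (F : Frontier V s) (c : Choices m s) (g : Continuation V s (decode V s c)) →
                encode F (decode V s c) g ≡ c
encode-decode {m = zero}  F tt      _ = refl
encode-decode {m = suc m} F (r , c) g with continuation-∷⇒ F g
... | r′ , Vr≡Vr′ , g′
    with toℕ-injective (Frontier.injective F (toℕ<n r) (toℕ<n r′) (ℤ.+-injective Vr≡Vr′))
... | refl = cong (r ,_) (encode-decode (Frontier-after F (toℕ<n r)) c g′)

Frontier-initial : Frontier (const 1) 1
Frontier-initial = record { decreasing = λ { i<j (s<s z≤n) → ⊥-elim (n≮0 i<j) } ; positive = λ _ → z<s }

allowedAt-initial⇔ : ∀ k x → AllowedAt (const 1) 1 k x ⇔ (+ 1 ℤ.≤ x × x ℤ.≤ + suc k)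
allowedAt-initial⇔ k x = mk⇔ (bounds x) (allowed x)
  where
  bounds : ∀ x → AllowedAt (const 1) 1 k x → + 1 ℤ.≤ x × x ℤ.≤ + suc k
  bounds (+ u) (0<u , inj₁ u≤k)               = +≤+ 0<u , +≤+ (m≤n⇒m≤1+n u≤k)
  bounds (+ u) (0<u , inj₂ (zero , _ , 1+k≡u)) = +≤+ 0<u , +≤+ (≤-reflexive (sym 1+k≡u))
  bounds (+ u) (_ , inj₂ (suc _ , s<s () , _))
  allowed : ∀ x → + 1 ℤ.≤ x × x ℤ.≤ + suc k → AllowedAt (const 1) 1 k x
  allowed (+ u) (+≤+ 0<u , +≤+ u≤1+k) with m≤n⇒m<n∨m≡n u≤1+k
  ... | inj₁ u<1+k = 0<u , inj₁ (≤-pred u<1+k)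
  ... | inj₂ refl  = 0<u , inj₂ (0 , z<s , refl)

InB⇔Continuation : ∀ {n} (v : Vec ℤ n) → InB v ⇔ Continuation (const 1) 1 v
InB⇔Continuation v = mk⇔
  (λ (bounded , nonBlocking) →
     (λ j → from (allowedAt-initial⇔ (toℕ j) (lookup v j)) (bounded j)) , nonBlocking)
  (λ (allowed , nonBlocking) →
     (λ j → to (allowedAt-initial⇔ (toℕ j) (lookup v j)) (allowed j)) , nonBlocking)

Σ-True-≡ : ∀ {A : Set} {P : A → Set} (P? : ∀ a → Dec (P a)) {a b : A} → a ≡ b →
           (t : True (P? a)) (t′ : True (P? b)) → (a , t) ≡ (b , t′)
Σ-True-≡ P? refl t t′ = cong (_ ,_) (T-irrelevant t t′)

Choices↔B : ∀ n → Choices n 1 ↔ Σ (Vec ℤ n) (λ v → True (InB? v))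
Choices↔B n = mk↔ₛ′ sequence choices sequence∘choices choices∘sequence
  where
  sequence : Choices n 1 → Σ (Vec ℤ n) (λ v → True (InB? v))
  sequence c = let v = decode (const 1) 1 c in
    v , fromWitness (from (InB⇔Continuation v) (decode-continuation Frontier-initial c))
  choices : Σ (Vec ℤ n) (λ v → True (InB? v)) → Choices n 1
  choices (v , t) = encode Frontier-initial v (to (InB⇔Continuation v) (toWitness t))
  sequence∘choices : ∀ b → sequence (choices b) ≡ b
  sequence∘choices (v , t) = Σ-True-≡ InB? (decode-encode Frontier-initial v _) _ t
  choices∘sequence : ∀ c → choices (sequence c) ≡ c
  choices∘sequence c = encode-decode Frontier-initial c _

proposition3 : (n : ℕ) → Fin (catalan n) ↔ Σ (Vec ℤ n) (λ v → True (InB? v))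
proposition3 n rewrite catalan≡ballot n = ↔-trans (Fin-ballot↔Choices n 1) (Choices↔B n)
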